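{- Let $G$ be a finite simple graph, $v_0 \in V(G)$, and $P$ a longest $v_0$-path in $G$. Then for all $v \in L(G,P,v_0)$ and all $P_v \in \mathcal{T}_v$, we have $L(G,P,v_0) \cap V(\mathrm{Front}^*(P_v)) = \emptyset$.
   Context: For $v\in V(G)$, $c(v)$ is the length of the longest cycle containing $v$, or $2$ if $v$ is on no cycle. A $v_0$-path is a path starting at $v_0$; its other end is its terminal vertex; a longest $v_0$-path is one of maximum length among $v_0$-paths. If $Q = v_0v_1\dots v_k$ is a longest $v_0$-path and $v_k$ is adjacent to $v_j$ for some $0 \le j \le k-2$, the path $v_0v_1\dots v_jv_kv_{k-1}\dots v_{j+1}$ is a simple transform of $Q$. A transform of $P$ is any path obtained from $P$ by a finite sequence of simple transforms; $\mathcal{T}$ is the set of all transforms. $L(G,P,v_0)$ is the set of terminal vertices of paths in $\mathcal{T}$; for $v \in L(G,P,v_0)$, $\mathcal{T}_v$ is the set of paths in $\mathcal{T}$ with terminal vertex $v$. For $P_v \in \mathcal{T}_v$, the pivot $w(P_v)$ is the vertex of $P_v$ at distance $c(v)-1$ from $v$ along $P_v$ (on the $v_0$ side), $\mathrm{Front}^*(P_v)$ is the subpath of $P_v$ from $v_0$ to $w(P_v)$, and $\mathrm{Back}^*(P_v)$ is the subpath from $w(P_v)$ to $v$. -}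

module Defs where

open import Data.Nat using (ℕ; suc; _≤_; _∸_)
open import Data.Fin using (Fin)
open import Data.List using (List; []; _∷_; _++_; _∷ʳ_; reverse; length; take)
open import Data.List.Relation.Unary.Linked using (Linked)
open import Data.List.Relation.Unary.Unique.Propositional using (Unique)
open import Data.List.Membership.Propositional using (_∈_)
open import Data.Product using (Σ; _×_; ∃)
open import Relation.Nullary using (¬_)
open import Relation.Binary.PropositionalEquality using (_≡_)
open import Relation.Binary.Construct.Closure.ReflexiveTransitive using (Star)

record SimpleGraph (n : ℕ) : Set₁ where
  field
    Adj     : Fin n → Fin n → Set
    symm    : ∀ {x y} → Adj x y → Adj y x
    irrefl  : ∀ {x} → ¬ Adj x x
open SimpleGraph public

module _ {n : ℕ} (G : SimpleGraph n) where

  IsPath : List (Fin n) → Set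
  IsPath xs = Unique xs × Linked (Adj G) xs

  -- A v₀-path is a path whose vertex list is  v₀ ∷ rs ; its length is  length rs.
  -- A longest v₀-path: maximal length among all v₀-paths.
  IsLongestPath : Fin n → List (Fin n) → Set
  IsLongestPath v₀ rs =
    IsPath (v₀ ∷ rs) × (∀ rs' → IsPath (v₀ ∷ rs') → length rs' ≤ length rs)

  IsCycle : List (Fin n) → Set
  IsCycle [] = Data.Empty.⊥ where import Data.Empty
  IsCycle (x ∷ xs) = (2 ≤ length xs) × Unique (x ∷ xs) × Linked (Adj G) ((x ∷ xs) ∷ʳ x)

  -- CycLen v c  :  c = c(v), i.e. c is the length of a longest cycle through v,
  -- or c = 2 if v lies on no cycle.
  CycLen : Fin n → ℕ → Set
  CycLen v c =
    (Σ (List (Fin n)) (λ C → IsCycle C × v ∈ C × length C ≡ c)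
       × (∀ C → IsCycle C → v ∈ C → length C ≤ c))
    Data.Sum.⊎
    ((∀ C → IsCycle C → ¬ (v ∈ C)) × c ≡ 2)
    where import Data.Sum

  -- Simple transform: Q = (as ∷ʳ a) ++ (bs ∷ʳ b) with bs nonempty (so the
  -- index j of a satisfies j ≤ k-2) and b (terminal) adjacent to a;
  -- result (as ∷ʳ a) ++ reverse (bs ∷ʳ b).
  data SimpleTransform : List (Fin n) → List (Fin n) → Set where
    st : ∀ as a b′ bs b → Adj G b a →
         SimpleTransform ((as ∷ʳ a) ++ ((b′ ∷ bs) ∷ʳ b))
                         ((as ∷ʳ a) ++ reverse ((b′ ∷ bs) ∷ʳ b))

  Transform : List (Fin n) → List (Fin n) → Set
  Transform = Star SimpleTransform

  Terminal : List (Fin n) → Fin n → Set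
  Terminal Q v = Σ (List (Fin n)) (λ qs → Q ≡ qs ∷ʳ v)

  InL : List (Fin n) → Fin n → Set
  InL P v = Σ (List (Fin n)) (λ Q → Transform P Q × Terminal Q v)

-- Front*(P_v) given c = c(v): the prefix of P_v from v₀ up to the vertex at
-- distance c-1 from the terminal vertex (positions 0 .. k-(c-1), k = length).
-- If that vertex does not exist (k < c-1) the prefix is empty.
Front* : {n : ℕ} → List (Fin n) → ℕ → List (Fin n)
Front* Pv c = take (length Pv ∸ (c ∸ 1)) Pv

-- Write P_v = Front*(P_v) ++ R, so that R consists of the last c(v) - 1 vertices of
-- P_v and ends in v. A simple transform along an edge from the end to a vertex a
-- reverses the segment Y after a, and a ∷ Y is a cycle. If Y reached into Front*(P_v)
-- it would contain all of R, so this cycle would pass through v and have more than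
-- c(v) vertices, which is impossible. Hence simple transforms, in either direction,
-- keep Front*(P_v) as a prefix and only permute the rest. Going back from P_v to P and
-- forward to any transform Q, the terminal vertex of Q lies in the nonempty rest, so
-- it is not in Front*(P_v) since Q is a path.
module Submission where

open import Defs
open import Data.Nat using (ℕ)
open import Data.Fin using (Fin)
open import Data.List using (List; _∷_)
open import Data.List.Membership.Propositional using (_∈_)
open import Relation.Nullary using (¬_)

open import Data.Empty using (⊥-elim)
open import Data.Nat using (suc; _≤_; _<_; _∸_; z≤n; s≤s)
open import Data.Nat.Properties
  using (≤-trans; ≤-refl; <⇒≤; <⇒≱; m≤n⇒m≤1+n; m≤n+m; m≤n+m∸n; ∸-monoˡ-≤; m∸n≢0⇒n<m; m∸[m∸n]≡n)
open import Data.List using ([]; _++_; _∷ʳ_; [_]; reverse; length; take; drop)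
open import Data.List.Properties
  using (∷-injective; ∷-injectiveʳ; ++-assoc; length-++; length-++-≤ʳ; length-drop; take++drop≡id;
         unfold-reverse; reverse-++)
open import Data.List.Membership.Propositional using (_∉_)
open import Data.List.Membership.Propositional.Properties using (∈-++⁺ʳ)
open import Data.List.Relation.Binary.Disjoint.Propositional using (Disjoint)
open import Data.List.Relation.Binary.Permutation.Propositional using (_↭_; ↭-sym; ↭⇒↭ₛ)
open import Data.List.Relation.Binary.Permutation.Propositional.Properties
  using (∈-resp-↭; ↭-length; ↭-reverse; ++⁺ˡ)
import Data.List.Relation.Binary.Permutation.Setoid.Properties as Permutationₛ
open import Data.List.Relation.Unary.Any using (here; there)
open import Data.List.Relation.Unary.All as All using ()
open import Data.List.Relation.Unary.Linked using (Linked; []; [-]; _∷_)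
open import Data.List.Relation.Unary.Unique.Propositional using (Unique; []; _∷_)
open import Data.Product using (∃; ∃₂; _×_; _,_; proj₁)
open import Data.Sum using (_⊎_; inj₁; inj₂)
open import Level using (Level)
open import Relation.Binary.Core using (Rel)
open import Relation.Binary.Definitions using (Symmetric)
open import Relation.Binary.PropositionalEquality using (_≡_; _≢_; refl; sym; trans; cong; subst; setoid)
open import Relation.Binary.Construct.Closure.ReflexiveTransitive using (ε; _◅_)

module _ {A : Set} where

  module _ {ℓ : Level} {R : Rel A ℓ} where

    Linked-++⁻ˡ : ∀ xs {ys} → Linked R (xs ++ ys) → Linked R xs
    Linked-++⁻ˡ []           _         = []
    Linked-++⁻ˡ (_ ∷ [])     _         = [-]
    Linked-++⁻ˡ (_ ∷ y ∷ xs) (r ∷ rs)  = r ∷ Linked-++⁻ˡ (y ∷ xs) rs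

    Linked-++⁻ʳ : ∀ xs {ys} → Linked R (xs ++ ys) → Linked R ys
    Linked-++⁻ʳ []                      rs       = rs
    Linked-++⁻ʳ (_ ∷ [])     {[]}       _        = []
    Linked-++⁻ʳ (_ ∷ [])     {_ ∷ _}    (_ ∷ rs) = rs
    Linked-++⁻ʳ (_ ∷ y ∷ xs)            (_ ∷ rs) = Linked-++⁻ʳ (y ∷ xs) rs

    Linked-join : ∀ xs {x y ys} → Linked R (xs ∷ʳ x) → R x y → Linked R (y ∷ ys) →
                  Linked R ((xs ∷ʳ x) ++ (y ∷ ys))
    Linked-join []           _        r rs′ = r ∷ rs′
    Linked-join (_ ∷ [])     (r ∷ rs) s rs′ = r ∷ Linked-join [] rs s rs′
    Linked-join (_ ∷ z ∷ xs) (r ∷ rs) s rs′ = r ∷ Linked-join (z ∷ xs) rs s rs′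

    Linked-reverse : Symmetric R → ∀ {xs} → Linked R xs → Linked R (reverse xs)
    Linked-reverse R-sym []                      = []
    Linked-reverse R-sym [-]                     = [-]
    Linked-reverse R-sym {x ∷ y ∷ ys} (r ∷ rs) =
      subst (Linked R) (sym (trans (unfold-reverse x (y ∷ ys)) (cong (_∷ʳ x) (unfold-reverse y ys))))
        (Linked-join (reverse ys)
          (subst (Linked R) (unfold-reverse y ys) (Linked-reverse R-sym rs)) (R-sym r) [-])

  Unique-resp-↭ : ∀ {xs ys : List A} → xs ↭ ys → Unique xs → Unique ys
  Unique-resp-↭ xs↭ys = Permutationₛ.Unique-resp-↭ (setoid A) (↭⇒↭ₛ xs↭ys)

  Unique-++⁻ʳ : ∀ xs {ys : List A} → Unique (xs ++ ys) → Unique ys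
  Unique-++⁻ʳ []       u        = u
  Unique-++⁻ʳ (_ ∷ xs) (_ ∷ u) = Unique-++⁻ʳ xs u

  Unique-++⇒Disjoint : ∀ xs {ys : List A} → Unique (xs ++ ys) → Disjoint xs ys
  Unique-++⇒Disjoint (_ ∷ xs) (x∉ ∷ _) (here refl , z∈ys)  = All.lookup x∉ (∈-++⁺ʳ xs z∈ys) refl
  Unique-++⇒Disjoint (_ ∷ xs) (_ ∷ u)  (there z∈xs , z∈ys) = Unique-++⇒Disjoint xs u (z∈xs , z∈ys)

  ++-≡-++-split : ∀ (F : List A) {R} X {Y} → F ++ R ≡ X ++ Y →
                  (∃ λ D → X ≡ F ++ D × R ≡ D ++ Y) ⊎ (∃₂ λ e E → Y ≡ (e ∷ E) ++ R)
  ++-≡-++-split []      X       eq = inj₁ (X , refl , eq)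
  ++-≡-++-split (f ∷ F) []      eq = inj₂ (f , F , sym eq)
  ++-≡-++-split (f ∷ F) (x ∷ X) eq with refl , eq′ ← ∷-injective eq
                                    with ++-≡-++-split F X eq′
  ... | inj₁ (D , X≡F++D , R≡D++Y) = inj₁ (D , cong (f ∷_) X≡F++D , R≡D++Y)
  ... | inj₂ Y≡e∷E++R             = inj₂ Y≡e∷E++R

  last-∈-suffix : ∀ F {R xs} {x : A} → F ++ R ≡ xs ∷ʳ x → 0 < length R → x ∈ R
  last-∈-suffix []          {xs = xs}    refl _     = ∈-++⁺ʳ xs (here refl)
  last-∈-suffix (_ ∷ [])    {xs = []}    refl ()
  last-∈-suffix (_ ∷ _ ∷ _) {xs = []}    ()
  last-∈-suffix (_ ∷ F)     {xs = _ ∷ _} eq   0<|R| = last-∈-suffix F (∷-injectiveʳ eq) 0<|R|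

  ∈-take⇒≢0 : ∀ k (xs : List A) {x} → x ∈ take k xs → k ≢ 0
  ∈-take⇒≢0 (suc _) _ _ ()

  module _ (v : A) (c : ℕ) where

    IsFront : List A → List A → Set
    IsFront F Q = ∃ λ R → Q ≡ F ++ R × v ∈ R × c ≤ suc (length R)

    Short : List A → Set
    Short Y = ¬ (v ∈ Y × c ≤ length Y)

    Short-resp-↭ : ∀ {Y Z} → Y ↭ Z → Short Z → Short Y
    Short-resp-↭ Y↭Z short (v∈Y , c≤|Y|) =
      short (∈-resp-↭ Y↭Z v∈Y , subst (c ≤_) (↭-length Y↭Z) c≤|Y|)

    ↭-keeps-front : ∀ {F} X {Y Z} → Y ↭ Z → Short Y → IsFront F (X ++ Y) → IsFront F (X ++ Z)
    ↭-keeps-front {F} X {Y} {Z} Y↭Z short (R , eq , v∈R , c≤1+|R|)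
      with ++-≡-++-split F X (sym eq)
    ... | inj₁ (D , refl , refl) =
      D ++ Z , ++-assoc F D Z , ∈-resp-↭ D++Y↭D++Z v∈R ,
      subst (λ m → c ≤ suc m) (↭-length D++Y↭D++Z) c≤1+|R|
      where D++Y↭D++Z = ++⁺ˡ D Y↭Z
    ... | inj₂ (e , E , refl) =
      ⊥-elim (short (∈-++⁺ʳ (e ∷ E) v∈R , ≤-trans c≤1+|R| (s≤s (length-++-≤ʳ R {E}))))

    terminal-∉-front : ∀ {F xs u} → IsFront F (xs ∷ʳ u) → Unique (xs ∷ʳ u) → u ∉ F
    terminal-∉-front {F} (_ ∷ _ , eq , _ , _) unique u∈F =
      Unique-++⇒Disjoint F (subst Unique eq unique) (u∈F , last-∈-suffix F (sym eq) (s≤s z≤n))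

module _ {n : ℕ} where

  front*-isFront : ∀ {c qs v u} → 2 ≤ c → u ∈ Front* (qs ∷ʳ v) c →
                   IsFront v c (Front* (qs ∷ʳ v) c) (qs ∷ʳ v)
  front*-isFront {c} {qs} {v} 2≤c u∈F =
    R , sym (take++drop≡id k Pv) , last-∈-suffix (take k Pv) (take++drop≡id k Pv) 0<|R| , c≤1+|R|
    where
    Pv : List (Fin n)
    Pv = qs ∷ʳ v
    k = length Pv ∸ (c ∸ 1)
    R = drop k Pv
    |R|≡c∸1 : length R ≡ c ∸ 1
    |R|≡c∸1 = trans (length-drop k Pv) (m∸[m∸n]≡n (<⇒≤ (m∸n≢0⇒n<m (∈-take⇒≢0 k Pv u∈F))))
    0<|R| : 0 < length R
    0<|R| = subst (0 <_) (sym |R|≡c∸1) (∸-monoˡ-≤ 1 2≤c)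
    c≤1+|R| : c ≤ suc (length R)
    c≤1+|R| = subst (λ m → c ≤ suc m) (sym |R|≡c∸1) (m≤n+m∸n c 1)

module _ {n : ℕ} (G : SimpleGraph n) where

  simpleTransform-isPath : ∀ {Q Q′} → SimpleTransform G Q Q′ → IsPath G Q → IsPath G Q′
  simpleTransform-isPath (st as a b′ bs b b~a) (unique , linked) =
    Unique-resp-↭ (++⁺ˡ (as ∷ʳ a) (↭-sym (↭-reverse Y))) unique ,
    subst (λ zs → Linked (Adj G) ((as ∷ʳ a) ++ zs)) (sym reverse-Y)
      (Linked-join as (Linked-++⁻ˡ (as ∷ʳ a) linked) (symm G b~a)
        (subst (Linked (Adj G)) reverse-Y (Linked-reverse (symm G) (Linked-++⁻ʳ (as ∷ʳ a) linked))))
    where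
    Y = (b′ ∷ bs) ∷ʳ b
    reverse-Y : reverse Y ≡ b ∷ reverse (b′ ∷ bs)
    reverse-Y = reverse-++ (b′ ∷ bs) [ b ]

  transform-isPath : ∀ {P Q} → Transform G P Q → IsPath G P → IsPath G Q
  transform-isPath ε        path = path
  transform-isPath (s ◅ ss) path = transform-isPath ss (simpleTransform-isPath s path)

  closing-isCycle : ∀ as {a b′ bs b} → Adj G b a → IsPath G ((as ∷ʳ a) ++ ((b′ ∷ bs) ∷ʳ b)) →
                    IsCycle G (a ∷ ((b′ ∷ bs) ∷ʳ b))
  closing-isCycle as {a} {b′} {bs} {b} b~a (unique , linked) =
    s≤s (subst (1 ≤_) (sym (length-++ bs)) (m≤n+m 1 (length bs))) ,
    Unique-++⁻ʳ as (subst Unique (++-assoc as [ a ] Y) unique) ,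
    Linked-join (a ∷ b′ ∷ bs) (Linked-++⁻ʳ as (subst (Linked (Adj G)) (++-assoc as [ a ] Y) linked)) b~a [-]
    where Y = (b′ ∷ bs) ∷ʳ b

  cycLen-maximal : ∀ {v c C} → CycLen G v c → IsCycle G C → v ∈ C → length C ≤ c
  cycLen-maximal (inj₁ (_ , maximal))  cycle v∈C = maximal _ cycle v∈C
  cycLen-maximal (inj₂ (acyclic , _)) cycle v∈C = ⊥-elim (acyclic _ cycle v∈C)

  cycLen≥2 : ∀ {v c} → CycLen G v c → 2 ≤ c
  cycLen≥2 (inj₁ ((_ ∷ _ , (2≤|xs| , _) , _ , refl) , _)) = m≤n⇒m≤1+n 2≤|xs|
  cycLen≥2 (inj₂ (_ , refl))                             = ≤-refl

  module _ {v c} (cv : CycLen G v c) where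

    closing-short : ∀ as {a b′ bs b} → Adj G b a → IsPath G ((as ∷ʳ a) ++ ((b′ ∷ bs) ∷ʳ b)) →
                    Short v c ((b′ ∷ bs) ∷ʳ b)
    closing-short as b~a path (v∈Y , c≤|Y|) =
      <⇒≱ (s≤s c≤|Y|) (cycLen-maximal cv (closing-isCycle as b~a path) (there v∈Y))

    simpleTransform-keeps-front : ∀ {F Q Q′} → SimpleTransform G Q Q′ → IsPath G Q →
                                  IsFront v c F Q → IsFront v c F Q′
    simpleTransform-keeps-front (st as a b′ bs b b~a) path =
      ↭-keeps-front v c (as ∷ʳ a) (↭-sym (↭-reverse _)) (closing-short as b~a path)

    simpleTransform-reflects-front : ∀ {F Q Q′} → SimpleTransform G Q Q′ → IsPath G Q →
                                     IsFront v c F Q′ → IsFront v c F Q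
    simpleTransform-reflects-front (st as a b′ bs b b~a) path =
      ↭-keeps-front v c (as ∷ʳ a) (↭-reverse _)
        (Short-resp-↭ v c (↭-reverse _) (closing-short as b~a path))

    transform-keeps-front : ∀ {F P Q} → Transform G P Q → IsPath G P →
                            IsFront v c F P → IsFront v c F Q
    transform-keeps-front ε        _    front = front
    transform-keeps-front (s ◅ ss) path front =
      transform-keeps-front ss (simpleTransform-isPath s path) (simpleTransform-keeps-front s path front)

    transform-reflects-front : ∀ {F P Q} → Transform G P Q → IsPath G P →
                               IsFront v c F Q → IsFront v c F P
    transform-reflects-front ε        _    front = front
    transform-reflects-front (s ◅ ss) path front =
      simpleTransform-reflects-front s path (transform-reflects-front ss (simpleTransform-isPath s path) front)

corollary2p18 : (n : ℕ) (G : SimpleGraph n) (v₀ : Fin n) (rs : List (Fin n)) →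
    IsLongestPath G v₀ rs →
    (v : Fin n) → InL G (v₀ ∷ rs) v →
    (Pv : List (Fin n)) → Transform G (v₀ ∷ rs) Pv → Terminal G Pv v →
    (c : ℕ) → CycLen G v c →
    (u : Fin n) → u ∈ Front* Pv c → ¬ InL G (v₀ ∷ rs) u
corollary2p18 n G v₀ rs (isPath , _) v _ _ P↝Pv (qs , refl) c cv u u∈F (_ , P↝Q , (_ , refl)) =
  terminal-∉-front v c front-of-Q (proj₁ (transform-isPath G P↝Q isPath)) u∈F
  where
  front-of-Pv = front*-isFront (cycLen≥2 G cv) u∈F
  front-of-P  = transform-reflects-front G cv P↝Pv isPath front-of-Pv
  front-of-Q  = transform-keeps-front G cv P↝Q isPath front-of-P
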